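{- Let $G$ be a looped simple graph and $S \in \mathcal{S}(G)$ a subtransversal of $W(G)$. Then $S$ is a transverse circuit of $G$ if and only if there exist a looped simple graph $H$ locally equivalent to $G$ and an induced isomorphism $\beta: M[IAS(G)]\to M[IAS(H)]$ such that $\beta(S)=\zeta_H(v)$ is the neighborhood circuit of some vertex $v$ of $H$.
   Context: A looped simple graph is a finite graph in which loops are allowed but no two edges have the same set of end-vertices. "Adjacent"/"neighbors" refer only to distinct vertices; $N_G(v)$ is the open neighborhood of $v$ (not containing $v$). $A(G)$ is the $V(G)\times V(G)$ adjacency matrix over $GF(2)$, with diagonal entry $1$ exactly at looped vertices. $IAS(G)$ is the $GF(2)$-matrix $(I \; A(G) \; A(G)+I)$; for $v\in V(G)$ the $v$ columns of $I$, $A(G)$, $A(G)+I$ are labeled $\phi_G(v)$, $\chi_G(v)$, $\psi_G(v)$. $W(G)$ is the set of these labels and $M[IAS(G)]$ (the isotropic matroid) is the binary matroid on $W(G)$ represented by $IAS(G)$. The vertex triple of $v$ is $\tau_G(v)=\{\phi_G(v),\chi_G(v),\psi_G(v)\}$. A subtransversal is a subset of $W(G)$ containing at most one element of each vertex triple; a transversal contains exactly one; $\mathcal{S}(G)$, $\mathcal{T}(G)$ denote these families. A transverse circuit of $G$ is a subtransversal that is a circuit of $M[IAS(G)]$. Local equivalence: for $v \in V(G)$, $G^v_\ell$ complements the loop status of $v$; $G^v_s$ complements the adjacency status of every pair of distinct neighbors of $v$; $G^v_{ns}$ does the same and also complements the loop status of every neighbor of $v$. $H$ is locally equivalent to $G$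 if obtained from $G$ by a finite sequence of such operations (so $V(H)=V(G)$). For $*\in\{\ell,s,ns\}$ there is an isomorphism $\beta^v_*: M[IAS(G)]\to M[IAS(G^v_*)]$ with $\beta^v_*(\alpha_G(x))=\alpha_{G^v_*}(x)$ for all $\alpha\in\{\phi,\chi,\psi\}$, $x\in V(G)$, except: $\beta^v_\ell$ swaps $\chi(v)$ and $\psi(v)$; $\beta^v_{ns}$ sends $\phi_G(v)\mapsto\psi(v)$, $\psi_G(v)\mapsto \phi(v)$ if $v$ is unlooped, and $\phi_G(v)\mapsto\chi(v)$, $\chi_G(v)\mapsto\phi(v)$ if $v$ is looped; $\beta^v_s$ has the same exceptions at $v$ as $\beta^v_{ns}$ and additionally, for each $w\in N_G(v)$, $\chi_G(w)\mapsto \psi(w)$ and $\psi_G(w)\mapsto\chi(w)$. An induced isomorphism $M[IAS(G)]\to M[IAS(H)]$ is a composition of such maps along a sequence of these operations transforming $G$ into $H$. The neighborhood circuit of $v\in V(H)$ is $\zeta_H(v)=\{\chi_H(v)\}\cup\{\phi_H(w)\mid w\in N_H(v)\}$ if $v$ is unlooped, and $\{\psi_H(v)\}\cup\{\phi_H(w)\mid w\in N_H(v)\}$ if $v$ is looped. -}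

module Defs where

open import Data.Empty using (⊥-elim)
open import Data.Nat using (ℕ; zero; suc)
open import Data.Fin using (Fin; zero; suc; _≟_)
open import Data.Bool using (Bool; true; false; _∧_; _xor_; not; if_then_else_)
open import Data.Product using (Σ; ∃; ∃-syntax; _×_; _,_)
open import Data.List using (List; []; _∷_)
open import Relation.Nullary using (¬_)
open import Relation.Nullary.Decidable using (⌊_⌋)
open import Relation.Binary.PropositionalEquality using (_≡_; refl; sym; cong₂)
open import Data.Bool.Properties using (∧-comm)
open import Relation.Nullary using (yes; no)
open import Function using (_∘_; id)

-- Looped simple graph on vertex set Fin n, given by its symmetric
-- GF(2) adjacency matrix A(G) (diagonal entry = loop).
record Graph (n : ℕ) : Set where
  field
    adj : Fin n → Fin n → Bool
    adj-sym : ∀ u v → adj u v ≡ adj v u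
open Graph public

eqᵇ : ∀ {n} → Fin n → Fin n → Bool
eqᵇ u v = ⌊ u ≟ v ⌋

nbr : ∀ {n} → Graph n → Fin n → Fin n → Bool
nbr G v w = not (eqᵇ v w) ∧ adj G v w

data Kind : Set where
  φ χ ψ : Kind

-- W(G) : labels (v , k) standing for φ_G(v), χ_G(v), ψ_G(v)
Label : ℕ → Set
Label n = Fin n × Kind

LSet : ℕ → Set
LSet n = Label n → Bool

-- Entry in row u of the column of IAS(G) labelled (v , k)
entry : ∀ {n} → Graph n → Label n → Fin n → Bool
entry G (v , φ) u = eqᵇ u v
entry G (v , χ) u = adj G u v
entry G (v , ψ) u = adj G u v xor eqᵇ u v

⊕Σ : ∀ {n} → (Fin n → Bool) → Bool
⊕Σ {zero} f = false
⊕Σ {suc n} f = f zero xor ⊕Σ (f ∘ suc)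

colSum : ∀ {n} → Graph n → LSet n → Fin n → Bool
colSum G T u = ⊕Σ λ v →
  ((T (v , φ) ∧ entry G (v , φ) u) xor (T (v , χ) ∧ entry G (v , χ) u))
    xor (T (v , ψ) ∧ entry G (v , ψ) u)

_⊆_ : ∀ {n} → LSet n → LSet n → Set
U ⊆ T = ∀ x → U x ≡ true → T x ≡ true

Nonempty : ∀ {n} → LSet n → Set
Nonempty U = ∃[ x ] U x ≡ true

Dependent : ∀ {n} → Graph n → LSet n → Set
Dependent G T = ∃[ U ] (U ⊆ T × Nonempty U × (∀ u → colSum G U u ≡ false))

_⊂_ : ∀ {n} → LSet n → LSet n → Set
T ⊂ S = T ⊆ S × (∃[ x ] (S x ≡ true × T x ≡ false))

Circuit : ∀ {n} → Graph n → LSet n → Set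
Circuit G S = Dependent G S × (∀ T → T ⊂ S → ¬ Dependent G T)

Subtransversal : ∀ {n} → LSet n → Set
Subtransversal S = ∀ v →
  ¬ (S (v , φ) ≡ true × S (v , χ) ≡ true) ×
  ¬ (S (v , φ) ≡ true × S (v , ψ) ≡ true) ×
  ¬ (S (v , χ) ≡ true × S (v , ψ) ≡ true)

TransverseCircuit : ∀ {n} → Graph n → LSet n → Set
TransverseCircuit G S = Subtransversal S × Circuit G S

data OpKind : Set where
  ℓ s ns : OpKind

Op : ℕ → Set
Op n = OpKind × Fin n

flipAdj : ∀ {n} → OpKind → Graph n → Fin n → Fin n → Fin n → Bool
flipAdj ℓ G v x y = adj G x y xor (eqᵇ x v ∧ eqᵇ y v)
flipAdj s G v x y = adj G x y xor ((nbr G v x ∧ nbr G v y) ∧ not (eqᵇ x y))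
flipAdj ns G v x y = adj G x y xor (nbr G v x ∧ nbr G v y)


eqᵇ-sym : ∀ {n} (x y : Fin n) → eqᵇ x y ≡ eqᵇ y x
eqᵇ-sym x y with x ≟ y | y ≟ x
... | yes _ | yes _ = refl
... | no _ | no _ = refl
... | yes p | no q = ⊥-elim (q (sym p))
... | no p | yes q = ⊥-elim (p (sym q))

flipAdj-sym : ∀ {n} k (G : Graph n) v x y → flipAdj k G v x y ≡ flipAdj k G v y x
flipAdj-sym ℓ G v x y = cong₂ _xor_ (Graph.adj-sym G x y) (∧-comm (eqᵇ x v) (eqᵇ y v))
flipAdj-sym s G v x y = cong₂ _xor_ (Graph.adj-sym G x y)
  (cong₂ _∧_ (∧-comm (nbr G v x) (nbr G v y)) (cong₂ (λ a (b : Bool) → not a) (eqᵇ-sym x y) (refl {x = true})))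
flipAdj-sym ns G v x y = cong₂ _xor_ (Graph.adj-sym G x y) (∧-comm (nbr G v x) (nbr G v y))

step : ∀ {n} → Op n → Graph n → Graph n
step (k , v) G = record { adj = flipAdj k G v ; adj-sym = flipAdj-sym k G v }

applyOps : ∀ {n} → List (Op n) → Graph n → Graph n
applyOps [] G = G
applyOps (o ∷ os) G = applyOps os (step o G)

βstep : ∀ {n} → Op n → Graph n → Label n → Label n
βstep (ℓ , v) G (w , k) with eqᵇ w v | k
... | true | χ = (w , ψ)
... | true | ψ = (w , χ)
... | _ | k' = (w , k')
βstep (ns , v) G (w , k) with eqᵇ w v | adj G v v | k
... | true | false | φ = (w , ψ)
... | true | false | ψ = (w , φ)
... | true | true | φ = (w , χ)
... | true | true | χ = (w , φ)
... | _ | _ | k' = (w , k')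
βstep (s , v) G (w , k) with eqᵇ w v | adj G v v | nbr G v w | k
... | true | false | _ | φ = (w , ψ)
... | true | false | _ | ψ = (w , φ)
... | true | true | _ | φ = (w , χ)
... | true | true | _ | χ = (w , φ)
... | false | _ | true | χ = (w , ψ)
... | false | _ | true | ψ = (w , χ)
... | _ | _ | _ | k' = (w , k')

induced : ∀ {n} → List (Op n) → Graph n → Label n → Label n
induced [] G = id
induced (o ∷ os) G = induced os (step o G) ∘ βstep o G

ζ : ∀ {n} → Graph n → Fin n → LSet n
ζ H v (w , φ) = nbr H v w
ζ H v (w , χ) = eqᵇ w v ∧ not (adj H v v)
ζ H v (w , ψ) = eqᵇ w v ∧ adj H v v

module Submission where

-- Backward direction.  Each β^v_* permutes every vertex triple, and the
-- column of IAS(G^v_*) at β(x) is the column of IAS(G) at x transformed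
-- by the invertible row operation y ↦ y + y(v)·m (m = 0 for ℓ, m = N(v)
-- for s and ns) [column-step].  Hence β preserves and reflects
-- dependence, so it is a matroid isomorphism [step-isomorphism] and
-- circuits pull back along induced isomorphisms [induced-circuit].  A
-- direct computation shows that ζ_H(v) is a circuit [ζ-circuit].
--
-- Forward direction, by induction on the number of vertex triples that
-- the transverse circuit S meets outside φ [weight].  Pick such a vertex
-- w.  If S holds the element of w that is not in ζ_G(w), local
-- complementation at w turns it into φ(w) and lowers the weight
-- [pivot-misplaced].  Otherwise, if some neighbour y of w has φ(y) ∉ S,
-- local complementation at y creates that situation at w without raising
-- the weight [pivot-neighbour].  Otherwise ζ_G(w) ⊆ S, so S = ζ_G(w) by
-- minimality [close-up].  If no such w exists, S consists of φ's, which
-- are independent [φ-only-independent].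

open import Defs
open import Algebra.Bundles using (CommutativeRing)
open import Data.Bool using (Bool; true; false; _∧_; _∨_; _xor_; not; if_then_else_)
open import Data.Bool.Properties
  using (∧-zeroʳ; ∧-identityʳ; ∧-conicalˡ; ∧-conicalʳ; ∨-identityʳ; ∨-zeroʳ; ∨-conicalˡ; ∨-conicalʳ;
         xor-identityʳ; xor-same; xor-assoc; ¬-not; not-injective; xor-∧-commutativeRing)
import Data.Bool.Properties as Bool
open import Data.Bool.Solver using (module xor-∧-Solver)
open import Data.Empty using (⊥; ⊥-elim)
open import Data.Fin using (Fin; zero; suc; _≟_; punchIn)
open import Data.Fin.Properties using (punchInᵢ≢i; any?)
open import Data.Fin.Subset using (Subset; ∣_∣)
import Data.Fin.Subset as Subset
open import Data.Fin.Subset.Properties using (p⊆q⇒∣p∣≤∣q∣; p⊂q⇒∣p∣<∣q∣)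
open import Data.List using (List; []; _∷_)
open import Data.Nat using (ℕ; zero; suc; _≤_; _<_)
open import Data.Nat.Induction using (<-rec)
open import Data.Nat.Properties using (<-≤-trans)
open import Data.Product using (∃-syntax; _×_; _,_; proj₁; proj₂; swap)
open import Data.Vec using (tabulate)
open import Data.Vec.Properties using (lookup∘tabulate; []=⇒lookup; lookup⇒[]=)
open import Function using (_∘_)
open import Function.Bundles using (_⇔_; mk⇔)
open import Relation.Binary.PropositionalEquality
  using (_≡_; refl; sym; trans; cong; cong₂; _≢_; _≗_; module ≡-Reasoning)
open import Relation.Nullary using (¬_; yes; no)
open import Relation.Nullary.Decidable using (dec-true; dec-false; isYes≗does)

open import Algebra.Properties.Semiring.Sum (CommutativeRing.semiring xor-∧-commutativeRing)
  using (sum; sum-cong-≗; ∑-distrib-+; *-distribˡ-sum; sum-remove; sum-replicate-zero)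

open xor-∧-Solver using (solve; _:=_; _:+_; _:*_)

private
  variable
    n : ℕ

true≢false : true ≢ false
true≢false ()

eqᵇ-refl : (u : Fin n) → eqᵇ u u ≡ true
eqᵇ-refl u = trans (isYes≗does (u ≟ u)) (dec-true (u ≟ u) refl)

eqᵇ-≢ : {u w : Fin n} → u ≢ w → eqᵇ u w ≡ false
eqᵇ-≢ {u = u} {w} u≢w = trans (isYes≗does (u ≟ w)) (dec-false (u ≟ w) u≢w)

eqᵇ-true : {u w : Fin n} → eqᵇ u w ≡ true → u ≡ w
eqᵇ-true {u = u} {w} e with u ≟ w
... | yes u≡w = u≡w
eqᵇ-true () | no _

nbr-self : (G : Graph n) (v : Fin n) → nbr G v v ≡ false
nbr-self G v = cong (λ b → not b ∧ adj G v v) (eqᵇ-refl v)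

nbr-sym : (G : Graph n) (v w : Fin n) → nbr G v w ≡ nbr G w v
nbr-sym G v w = cong₂ (λ a b → not a ∧ b) (eqᵇ-sym v w) (adj-sym G v w)

nbr-off : (G : Graph n) {v w : Fin n} → v ≢ w → nbr G v w ≡ adj G v w
nbr-off G v≢w = cong (λ b → not b ∧ _) (eqᵇ-≢ v≢w)

adj-column : (G : Graph n) (v u : Fin n) →
  adj G u v ≡ nbr G v u xor (eqᵇ u v ∧ adj G v v)
adj-column G v u with u ≟ v
... | yes refl = cong (_xor adj G u u) (sym (nbr-self G u))
... | no u≢v = trans (sym (xor-identityʳ _))
                 (cong (_xor false) (trans (adj-sym G u v) (sym (nbr-off G (λ e → u≢v (sym e))))))

-- Each map β^v_* permutes every vertex triple within itself; these are
-- the permutations of {φ, χ, ψ} that occur.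

data TriplePerm : Set where
  keep swapχψ swapφψ swapφχ : TriplePerm

permute : TriplePerm → Kind → Kind
permute keep   k = k
permute swapχψ φ = φ
permute swapχψ χ = ψ
permute swapχψ ψ = χ
permute swapφψ φ = ψ
permute swapφψ χ = χ
permute swapφψ ψ = φ
permute swapφχ φ = χ
permute swapφχ χ = φ
permute swapφχ ψ = ψ

permute-involutive : ∀ p k → permute p (permute p k) ≡ k
permute-involutive keep   k = refl
permute-involutive swapχψ φ = refl
permute-involutive swapχψ χ = refl
permute-involutive swapχψ ψ = refl
permute-involutive swapφψ φ = refl
permute-involutive swapφψ χ = refl
permute-involutive swapφψ ψ = refl
permute-involutive swapφχ φ = refl
permute-involutive swapφχ χ = refl
permute-involutive swapφχ ψ = refl

pivotSwap : Bool → TriplePerm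
pivotSwap false = swapφψ
pivotSwap true  = swapφχ

βperm : Op n → Graph n → Fin n → TriplePerm
βperm (ℓ  , v) G w = if eqᵇ w v then swapχψ else keep
βperm (ns , v) G w = if eqᵇ w v then pivotSwap (adj G v v) else keep
βperm (s  , v) G w =
  if eqᵇ w v then pivotSwap (adj G v v) else (if nbr G v w then swapχψ else keep)

βstep-perm : (o : Op n) (G : Graph n) (w : Fin n) (k : Kind) →
  βstep o G (w , k) ≡ (w , permute (βperm o G w) k)
βstep-perm (ℓ , v) G w k with eqᵇ w v | k
... | true  | φ = refl
... | true  | χ = refl
... | true  | ψ = refl
... | false | _ = refl
βstep-perm (ns , v) G w k with eqᵇ w v | adj G v v | k
... | true  | false | φ = refl
... | true  | false | χ = refl
... | true  | false | ψ = refl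
... | true  | true  | φ = refl
... | true  | true  | χ = refl
... | true  | true  | ψ = refl
... | false | _     | _ = refl
βstep-perm (s , v) G w k with eqᵇ w v | adj G v v | nbr G v w | k
... | true  | false | _     | φ = refl
... | true  | false | _     | χ = refl
... | true  | false | _     | ψ = refl
... | true  | true  | _     | φ = refl
... | true  | true  | _     | χ = refl
... | true  | true  | _     | ψ = refl
... | false | _     | true  | φ = refl
... | false | _     | true  | χ = refl
... | false | _     | true  | ψ = refl
... | false | _     | false | _ = refl

βstep-involutive : (o : Op n) (G : Graph n) (x : Label n) → βstep o G (βstep o G x) ≡ x
βstep-involutive o G (w , k) = begin
  βstep o G (βstep o G (w , k))    ≡⟨ cong (βstep o G) (βstep-perm o G w k) ⟩
  βstep o G (w , permute p k)      ≡⟨ βstep-perm o G w (permute p k) ⟩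
  (w , permute p (permute p k))    ≡⟨ cong (w ,_) (permute-involutive p k) ⟩
  (w , k)                          ∎
  where
  open ≡-Reasoning
  p = βperm o G w

-- Row u of the column of kind k, in terms of the A-entry a and the I-entry e.
kindEntry : Kind → Bool → Bool → Bool
kindEntry φ a e = e
kindEntry χ a e = a
kindEntry ψ a e = a xor e

entry-kind : (G : Graph n) (w : Fin n) (k : Kind) (u : Fin n) →
  entry G (w , k) u ≡ kindEntry k (adj G u w) (eqᵇ u w)
entry-kind G w φ u = refl
entry-kind G w χ u = refl
entry-kind G w ψ u = refl

kindEntry-linear : ∀ k a e a′ e′ c →
  kindEntry k a e xor (c ∧ kindEntry k a′ e′) ≡ kindEntry k (a xor (c ∧ a′)) (e xor (c ∧ e′))
kindEntry-linear φ a e a′ e′ c = refl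
kindEntry-linear χ a e a′ e′ c = refl
kindEntry-linear ψ = solve 5 (λ a e a′ e′ c →
  (a :+ e) :+ (c :* (a′ :+ e′)) := (a :+ (c :* a′)) :+ (e :+ (c :* e′))) refl

swapχψ-kindEntry : ∀ k a e → kindEntry (permute swapχψ k) (a xor e) e ≡ kindEntry k a e
swapχψ-kindEntry φ a e = refl
swapχψ-kindEntry χ = solve 2 (λ a e → (a :+ e) :+ e := a) refl
swapχψ-kindEntry ψ a e = refl

-- The triple of the pivot v, in row u: with m = [u ∈ N(v)] and e = [u = v]
-- (never both true) and L the loop status of v, the A-entry is m ⊕ e·L;
-- the row operation adds m·(L , 1) to (A-entry , I-entry), which
-- amounts to applying pivotSwap L.
pivot-kindEntry : ∀ k L m e → m ∧ e ≡ false →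
  kindEntry (permute (pivotSwap L) k) (m xor (e ∧ L)) e ≡
    kindEntry k ((m xor (e ∧ L)) xor (m ∧ L)) (e xor m)
pivot-kindEntry k     L     true  true  ()
pivot-kindEntry φ     false false false _ = refl
pivot-kindEntry φ     false false true  _ = refl
pivot-kindEntry φ     false true  false _ = refl
pivot-kindEntry φ     true  false false _ = refl
pivot-kindEntry φ     true  false true  _ = refl
pivot-kindEntry φ     true  true  false _ = refl
pivot-kindEntry χ     false false false _ = refl
pivot-kindEntry χ     false false true  _ = refl
pivot-kindEntry χ     false true  false _ = refl
pivot-kindEntry χ     true  false false _ = refl
pivot-kindEntry χ     true  false true  _ = refl
pivot-kindEntry χ     true  true  false _ = refl
pivot-kindEntry ψ     false false false _ = refl
pivot-kindEntry ψ     false false true  _ = refl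
pivot-kindEntry ψ     false true  false _ = refl
pivot-kindEntry ψ     true  false false _ = refl
pivot-kindEntry ψ     true  false true  _ = refl
pivot-kindEntry ψ     true  true  false _ = refl

-- The row operation y ↦ y + y(v)·m on column vectors (m(v) = 0 below,
-- so it is invertible).
rowOp : (Fin n → Bool) → Fin n → (Fin n → Bool) → Fin n → Bool
rowOp m v y u = y u xor (m u ∧ y v)

rowOp-entry : (m : Fin n → Bool) (v : Fin n) (G : Graph n) (w : Fin n) (k : Kind) (u : Fin n) →
  rowOp m v (entry G (w , k)) u ≡
    kindEntry k (adj G u w xor (m u ∧ adj G v w)) (eqᵇ u w xor (m u ∧ eqᵇ v w))
rowOp-entry m v G w k u =
  trans (cong₂ (λ a b → a xor (m u ∧ b)) (entry-kind G w k u) (entry-kind G w k v))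
        (kindEntry-linear k _ _ _ _ (m u))

-- The row operation relating IAS(G) and IAS(G^v_*): none for ℓ, and
-- adding row v to the rows of the neighbours of v for s and ns.
multiplier : Op n → Graph n → Fin n → Bool
multiplier (ℓ  , v) G u = false
multiplier (s  , v) G u = nbr G v u
multiplier (ns , v) G u = nbr G v u

-- The multiplier vanishes at the pivot, which makes the row operation invertible.
multiplier-pivot : (o : Op n) (G : Graph n) → multiplier o G (proj₂ o) ≡ false
multiplier-pivot (ℓ  , v) G = refl
multiplier-pivot (s  , v) G = nbr-self G v
multiplier-pivot (ns , v) G = nbr-self G v

-- The three operations, column by column: ℓ adds e_v to the χ-column of v.
column-ℓ : (G : Graph n) (v w : Fin n) (k : Kind) (u : Fin n) →
  kindEntry (permute (βperm (ℓ , v) G w) k) (flipAdj ℓ G v u w) (eqᵇ u w) ≡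
    kindEntry k (adj G u w xor false) (eqᵇ u w xor false)
column-ℓ G v w k u with w ≟ v
... | no _ = cong₂ (kindEntry k) (cong (adj G u w xor_) (∧-zeroʳ (eqᵇ u v)))
                                  (sym (xor-identityʳ (eqᵇ u w)))
... | yes refl = begin
  kindEntry (permute swapχψ k) (adj G u w xor (eqᵇ u w ∧ true)) (eqᵇ u w)
    ≡⟨ cong (λ b → kindEntry (permute swapχψ k) (adj G u w xor b) (eqᵇ u w)) (∧-identityʳ _) ⟩
  kindEntry (permute swapχψ k) (adj G u w xor eqᵇ u w) (eqᵇ u w)
    ≡⟨ swapχψ-kindEntry k (adj G u w) (eqᵇ u w) ⟩
  kindEntry k (adj G u w) (eqᵇ u w)
    ≡⟨ sym (cong₂ (kindEntry k) (xor-identityʳ _) (xor-identityʳ _)) ⟩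
  kindEntry k (adj G u w xor false) (eqᵇ u w xor false) ∎
  where open ≡-Reasoning

xor-∧-false : ∀ a c → a xor (c ∧ false) ≡ a
xor-∧-false a c = trans (cong (a xor_) (∧-zeroʳ c)) (xor-identityʳ a)

nbr-apart : (G : Graph n) (v u : Fin n) → nbr G v u ∧ eqᵇ u v ≡ false
nbr-apart G v u with u ≟ v
... | yes refl = cong (_∧ true) (nbr-self G u)
... | no _     = ∧-zeroʳ (nbr G v u)

column-offPivot : (G : Graph n) {v w : Fin n} → v ≢ w → (k : Kind) (u : Fin n) →
  kindEntry k (adj G u w xor (nbr G v u ∧ adj G v w)) (eqᵇ u w xor (nbr G v u ∧ eqᵇ v w)) ≡
    kindEntry k (adj G u w xor (nbr G v u ∧ nbr G v w)) (eqᵇ u w)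
column-offPivot G {v} {w} v≢w k u = cong₂ (kindEntry k)
  (cong (λ b → adj G u w xor (nbr G v u ∧ b)) (sym (nbr-off G v≢w)))
  (trans (cong (λ b → eqᵇ u w xor (nbr G v u ∧ b)) (eqᵇ-≢ v≢w)) (xor-∧-false _ _))

column-atPivot : (G : Graph n) (v : Fin n) (k : Kind) (u : Fin n) →
  kindEntry (permute (pivotSwap (adj G v v)) k) (adj G u v) (eqᵇ u v) ≡
    kindEntry k (adj G u v xor (nbr G v u ∧ adj G v v)) (eqᵇ u v xor (nbr G v u ∧ eqᵇ v v))
column-atPivot G v k u = begin
  kindEntry (permute (pivotSwap L) k) (adj G u v) (eqᵇ u v)
    ≡⟨ cong (λ a → kindEntry (permute (pivotSwap L) k) a (eqᵇ u v)) (adj-column G v u) ⟩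
  kindEntry (permute (pivotSwap L) k) (m xor (eqᵇ u v ∧ L)) (eqᵇ u v)
    ≡⟨ pivot-kindEntry k L m (eqᵇ u v) (nbr-apart G v u) ⟩
  kindEntry k ((m xor (eqᵇ u v ∧ L)) xor (m ∧ L)) (eqᵇ u v xor m)
    ≡⟨ cong₂ (kindEntry k) (cong (λ a → a xor (m ∧ L)) (sym (adj-column G v u)))
                           (cong (λ b → eqᵇ u v xor b)
                                 (trans (sym (∧-identityʳ m)) (cong (m ∧_) (sym (eqᵇ-refl v))))) ⟩
  kindEntry k (adj G u v xor (m ∧ L)) (eqᵇ u v xor (m ∧ eqᵇ v v)) ∎
  where
  open ≡-Reasoning
  L = adj G v v
  m = nbr G v u

-- At a neighbour w of v, G^v_s toggles no loop whereas G^v_ns does;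
-- exchanging χ(w) and ψ(w) absorbs the difference.
s-offPivot-kindEntry : ∀ k a m c e → (e ≡ true → m ≡ c) →
  kindEntry (permute (if c then swapχψ else keep) k) (a xor ((m ∧ c) ∧ not e)) e ≡
    kindEntry k (a xor (m ∧ c)) e
s-offPivot-kindEntry k a false false e _ = refl
s-offPivot-kindEntry k a true  false e _ = refl
s-offPivot-kindEntry k a false true  true  h with h refl
... | ()
s-offPivot-kindEntry k false true  true  true  _ = swapχψ-kindEntry k true true
s-offPivot-kindEntry k true  true  true  true  _ = swapχψ-kindEntry k false true
s-offPivot-kindEntry k false false true  false _ = swapχψ-kindEntry k false false
s-offPivot-kindEntry k true  false true  false _ = swapχψ-kindEntry k true false
s-offPivot-kindEntry k false true  true  false _ = swapχψ-kindEntry k true false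
s-offPivot-kindEntry k true  true  true  false _ = swapχψ-kindEntry k false false

-- G^v_ns adds N(v)·N(v)ᵀ to A(G), matching the row operation on the
-- columns of all w ≠ v.
column-ns : (G : Graph n) (v w : Fin n) (k : Kind) (u : Fin n) →
  kindEntry (permute (βperm (ns , v) G w) k) (flipAdj ns G v u w) (eqᵇ u w) ≡
    kindEntry k (adj G u w xor (nbr G v u ∧ adj G v w)) (eqᵇ u w xor (nbr G v u ∧ eqᵇ v w))
column-ns G v w k u with w ≟ v
... | no w≢v   = sym (column-offPivot G (λ v≡w → w≢v (sym v≡w)) k u)
... | yes refl = trans
  (cong (λ a → kindEntry (permute (pivotSwap (adj G w w)) k) a (eqᵇ u w))
        (trans (cong (λ b → adj G u w xor (nbr G w u ∧ b)) (nbr-self G w)) (xor-∧-false _ _)))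
  (column-atPivot G w k u)

-- G^v_s differs from G^v_ns only in the loops of N(v).
column-s : (G : Graph n) (v w : Fin n) (k : Kind) (u : Fin n) →
  kindEntry (permute (βperm (s , v) G w) k) (flipAdj s G v u w) (eqᵇ u w) ≡
    kindEntry k (adj G u w xor (nbr G v u ∧ adj G v w)) (eqᵇ u w xor (nbr G v u ∧ eqᵇ v w))
column-s G v w k u with w ≟ v
... | no w≢v = trans
  (s-offPivot-kindEntry k (adj G u w) (nbr G v u) (nbr G v w) (eqᵇ u w)
                        (λ e → cong (nbr G v) (eqᵇ-true e)))
  (sym (column-offPivot G (λ v≡w → w≢v (sym v≡w)) k u))
... | yes refl = trans
  (cong (λ a → kindEntry (permute (pivotSwap (adj G w w)) k) a (eqᵇ u w))
        (trans (cong (λ b → adj G u w xor ((nbr G w u ∧ b) ∧ not (eqᵇ u w))) (nbr-self G w))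
               (trans (cong (λ b → adj G u w xor (b ∧ not (eqᵇ u w))) (∧-zeroʳ _))
                      (xor-identityʳ _))))
  (column-atPivot G w k u)

column-step : (o : Op n) (G : Graph n) (x : Label n) (u : Fin n) →
  entry (step o G) (βstep o G x) u ≡ rowOp (multiplier o G) (proj₂ o) (entry G x) u
column-step o@(κ , v) G (w , k) u = begin
  entry (step o G) (βstep o G (w , k)) u
    ≡⟨ cong (λ y → entry (step o G) y u) (βstep-perm o G w k) ⟩
  entry (step o G) (w , permute (βperm o G w) k) u
    ≡⟨ entry-kind (step o G) w (permute (βperm o G w) k) u ⟩
  kindEntry (permute (βperm o G w) k) (flipAdj κ G v u w) (eqᵇ u w)
    ≡⟨ byKind κ ⟩
  kindEntry k (adj G u w xor (m u ∧ adj G v w)) (eqᵇ u w xor (m u ∧ eqᵇ v w))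
    ≡⟨ sym (rowOp-entry m v G w k u) ⟩
  rowOp m v (entry G (w , k)) u ∎
  where
  open ≡-Reasoning
  m = multiplier o G
  byKind : ∀ κ → kindEntry (permute (βperm (κ , v) G w) k) (flipAdj κ G v u w) (eqᵇ u w) ≡
                   kindEntry k (adj G u w xor (multiplier (κ , v) G u ∧ adj G v w))
                               (eqᵇ u w xor (multiplier (κ , v) G u ∧ eqᵇ v w))
  byKind ℓ  = column-ℓ G v w k u
  byKind s  = column-s G v w k u
  byKind ns = column-ns G v w k u

-- GF(2) sums over the vertices: ⊕Σ is the monoid sum of the ring
-- (Bool, xor, ∧), so the library's summation lemmas apply.

⊕Σ-sum : (f : Fin n → Bool) → ⊕Σ f ≡ sum f
⊕Σ-sum {zero}  f = refl
⊕Σ-sum {suc n} f = cong (f zero xor_) (⊕Σ-sum (λ w → f (suc w)))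

⊕Σ-cong : {f g : Fin n → Bool} → (∀ w → f w ≡ g w) → ⊕Σ f ≡ ⊕Σ g
⊕Σ-cong {f = f} {g} f≗g = trans (⊕Σ-sum f) (trans (sum-cong-≗ f≗g) (sym (⊕Σ-sum g)))

⊕Σ-linear : (f g : Fin n → Bool) (c : Bool) →
  ⊕Σ (λ w → f w xor (c ∧ g w)) ≡ ⊕Σ f xor (c ∧ ⊕Σ g)
⊕Σ-linear f g c = begin
  ⊕Σ (λ w → f w xor (c ∧ g w))   ≡⟨ ⊕Σ-sum (λ w → f w xor (c ∧ g w)) ⟩
  sum (λ w → f w xor (c ∧ g w))  ≡⟨ ∑-distrib-+ f (λ w → c ∧ g w) ⟩
  sum f xor sum (λ w → c ∧ g w)  ≡⟨ cong (sum f xor_) (sym (*-distribˡ-sum c g)) ⟩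
  sum f xor (c ∧ sum g)          ≡⟨ sym (cong₂ (λ a b → a xor (c ∧ b)) (⊕Σ-sum f) (⊕Σ-sum g)) ⟩
  ⊕Σ f xor (c ∧ ⊕Σ g)            ∎
  where open ≡-Reasoning

⊕Σ-point : (f : Fin n → Bool) (u : Fin n) → (∀ w → w ≢ u → f w ≡ false) → ⊕Σ f ≡ f u
⊕Σ-point {zero}  f () _
⊕Σ-point {suc n} f u off-u = begin
  ⊕Σ f                                      ≡⟨ ⊕Σ-sum f ⟩
  sum f                                     ≡⟨ sum-remove {i = u} f ⟩
  f u xor sum (λ j → f (punchIn u j))       ≡⟨ cong (f u xor_) (sum-cong-≗ (λ j → off-u _ (punchInᵢ≢i u j))) ⟩
  f u xor sum {n} (λ _ → false)             ≡⟨ cong (f u xor_) (sum-replicate-zero n) ⟩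
  f u xor false                             ≡⟨ xor-identityʳ (f u) ⟩
  f u                                       ∎
  where open ≡-Reasoning

tripleSum : (Kind → Bool) → Bool
tripleSum f = (f φ xor f χ) xor f ψ

tripleSum-cong : {f g : Kind → Bool} → (∀ k → f k ≡ g k) → tripleSum f ≡ tripleSum g
tripleSum-cong f≗g = cong₂ _xor_ (cong₂ _xor_ (f≗g φ) (f≗g χ)) (f≗g ψ)

tripleSum-permute : ∀ p f → tripleSum (λ k → f (permute p k)) ≡ tripleSum f
tripleSum-permute keep   f = refl
tripleSum-permute swapχψ f = solve 3 (λ a b c → (a :+ c) :+ b := (a :+ b) :+ c) refl (f φ) (f χ) (f ψ)
tripleSum-permute swapφψ f = solve 3 (λ a b c → (c :+ b) :+ a := (a :+ b) :+ c) refl (f φ) (f χ) (f ψ)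
tripleSum-permute swapφχ f = solve 3 (λ a b c → (b :+ a) :+ c := (a :+ b) :+ c) refl (f φ) (f χ) (f ψ)

tripleSum-linear : ∀ (c x y : Kind → Bool) m →
  tripleSum (λ k → c k ∧ (x k xor (m ∧ y k))) ≡
    tripleSum (λ k → c k ∧ x k) xor (m ∧ tripleSum (λ k → c k ∧ y k))
tripleSum-linear c x y m = solve 10
  (λ c₁ c₂ c₃ x₁ x₂ x₃ y₁ y₂ y₃ m →
    ((c₁ :* (x₁ :+ (m :* y₁))) :+ (c₂ :* (x₂ :+ (m :* y₂)))) :+ (c₃ :* (x₃ :+ (m :* y₃))) :=
    (((c₁ :* x₁) :+ (c₂ :* x₂)) :+ (c₃ :* x₃)) :+ (m :* (((c₁ :* y₁) :+ (c₂ :* y₂)) :+ (c₃ :* y₃))))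
  refl (c φ) (c χ) (c ψ) (x φ) (x χ) (x ψ) (y φ) (y χ) (y ψ) m

-- The contribution of the triple of w to row u of the column sum of U,
-- so that colSum G U u is definitionally ⊕Σ (λ w → vertexTerm G U w u).
vertexTerm : Graph n → LSet n → Fin n → Fin n → Bool
vertexTerm G U w u = tripleSum (λ k → U (w , k) ∧ entry G (w , k) u)

-- Reindexing the triple of w by βperm turns the contribution of w in G^v_*
-- into the row-operated contribution of w in G.
vertexTerm-step : (o : Op n) (G : Graph n) (U : LSet n) (w u : Fin n) →
  vertexTerm (step o G) (U ∘ βstep o G) w u ≡
    vertexTerm G U w u xor (multiplier o G u ∧ vertexTerm G U w (proj₂ o))
vertexTerm-step o G U w u = begin
  tripleSum (λ k → U (βstep o G (w , k)) ∧ entry (step o G) (w , k) u)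
    ≡⟨ tripleSum-cong (λ k → cong₂ _∧_ (cong U (βstep-perm o G w k)) (entry′ k)) ⟩
  tripleSum (λ k → g (permute p k))
    ≡⟨ tripleSum-permute p g ⟩
  tripleSum g
    ≡⟨ tripleSum-linear (λ k → U (w , k)) (λ k → entry G (w , k) u) (λ k → entry G (w , k) v) (m u) ⟩
  vertexTerm G U w u xor (m u ∧ vertexTerm G U w v) ∎
  where
  open ≡-Reasoning
  v = proj₂ o
  m = multiplier o G
  p = βperm o G w
  g : Kind → Bool
  g k = U (w , k) ∧ rowOp m v (entry G (w , k)) u
  -- (w , k) is the image under β of (w , permute p k)
  entry′ : ∀ k → entry (step o G) (w , k) u ≡ rowOp m v (entry G (w , permute p k)) u
  entry′ k = begin
    entry (step o G) (w , k) u
      ≡⟨ cong (λ y → entry (step o G) (w , y) u) (sym (permute-involutive p k)) ⟩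
    entry (step o G) (w , permute p (permute p k)) u
      ≡⟨ cong (λ y → entry (step o G) y u) (sym (βstep-perm o G w (permute p k))) ⟩
    entry (step o G) (βstep o G (w , permute p k)) u
      ≡⟨ column-step o G (w , permute p k) u ⟩
    rowOp m v (entry G (w , permute p k)) u ∎

colSum-step : (o : Op n) (G : Graph n) (U : LSet n) (u : Fin n) →
  colSum (step o G) (U ∘ βstep o G) u ≡ rowOp (multiplier o G) (proj₂ o) (colSum G U) u
colSum-step o G U u =
  trans (⊕Σ-cong (λ w → vertexTerm-step o G U w u))
        (⊕Σ-linear (λ w → vertexTerm G U w u) (λ w → vertexTerm G U w (proj₂ o)) (multiplier o G u))

-- The row operation maps zero to zero and, as m(v) = 0, only zero to zero.
rowOp-zero : (m : Fin n → Bool) (v : Fin n) {y : Fin n → Bool} →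
  (∀ u → y u ≡ false) → ∀ u → rowOp m v y u ≡ false
rowOp-zero m v {y} y≡0 u = trans (cong₂ (λ a b → a xor (m u ∧ b)) (y≡0 u) (y≡0 v)) (∧-zeroʳ (m u))

rowOp-kernel : (m : Fin n → Bool) (v : Fin n) {y : Fin n → Bool} → m v ≡ false →
  (∀ u → rowOp m v y u ≡ false) → ∀ u → y u ≡ false
rowOp-kernel m v {y} mv≡0 Ry≡0 u = begin
  y u                    ≡⟨ sym (xor-∧-false (y u) (m u)) ⟩
  y u xor (m u ∧ false)  ≡⟨ cong (λ b → y u xor (m u ∧ b)) (sym yv≡0) ⟩
  rowOp m v y u          ≡⟨ Ry≡0 u ⟩
  false                  ∎
  where
  open ≡-Reasoning
  yv≡0 : y v ≡ false
  yv≡0 = trans (sym (trans (cong (λ b → y v xor (b ∧ y v)) mv≡0) (xor-identityʳ (y v)))) (Ry≡0 v)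

colSum-resp : (G : Graph n) {A B : LSet n} → A ≗ B → ∀ u → colSum G A u ≡ colSum G B u
colSum-resp G A≗B u = ⊕Σ-cong (λ w → tripleSum-cong (λ k → cong (_∧ entry G (w , k) u) (A≗B (w , k))))

Dependent-resp : (G : Graph n) {A B : LSet n} → A ≗ B → Dependent G A → Dependent G B
Dependent-resp G A≗B (U , U⊆A , U≠∅ , U≡0) = U , (λ x Ux → trans (sym (A≗B x)) (U⊆A x Ux)) , U≠∅ , U≡0

Circuit-resp : (G : Graph n) {A B : LSet n} → A ≗ B → Circuit G A → Circuit G B
Circuit-resp G A≗B (depA , minA) =
  Dependent-resp G A≗B depA ,
  λ T (T⊆B , (y , By , ¬Ty)) → minA T ((λ x Tx → trans (A≗B x) (T⊆B x Tx)) , (y , trans (A≗B y) By , ¬Ty))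

-- An involution of the labels under which dependent sets correspond:
-- an isomorphism M[IAS(G)] → M[IAS(G′)].
record Isomorphism (G G′ : Graph n) : Set where
  field
    relabel    : Label n → Label n
    involutive : ∀ x → relabel (relabel x) ≡ x
    preserves  : ∀ T → Dependent G T → Dependent G′ (T ∘ relabel)
    reflects   : ∀ T → Dependent G′ (T ∘ relabel) → Dependent G T

  inverse : Isomorphism G′ G
  inverse = record
    { relabel    = relabel
    ; involutive = involutive
    ; preserves  = λ T′ d → reflects (T′ ∘ relabel) (Dependent-resp G′ (λ x → cong T′ (sym (involutive x))) d)
    ; reflects   = λ T′ d → Dependent-resp G′ (λ x → cong T′ (involutive x)) (preserves (T′ ∘ relabel) d)
    }

  circuit : ∀ {T} → Circuit G T → Circuit G′ (T ∘ relabel)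
  circuit {T} (depT , minT) = preserves T depT , minimal
    where
    minimal : ∀ T′ → T′ ⊂ (T ∘ relabel) → ¬ Dependent G′ T′
    minimal T′ (T′⊆ , (y , Tfy , ¬T′y)) depT′ =
      minT (T′ ∘ relabel)
           ((λ x T′fx → trans (sym (cong T (involutive x))) (T′⊆ (relabel x) T′fx)) ,
            (relabel y , Tfy , trans (cong T′ (involutive y)) ¬T′y))
           (reflects (T′ ∘ relabel) (Dependent-resp G′ (λ x → cong T′ (sym (involutive x))) depT′))

step-isomorphism : (o : Op n) (G : Graph n) → Isomorphism G (step o G)
step-isomorphism {n} o G = record
  { relabel    = β
  ; involutive = βstep-involutive o G
  ; preserves  = preserves
  ; reflects   = reflects
  }
  where
  β = βstep o G
  ββ : ∀ (U : LSet n) x → U (β (β x)) ≡ U x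
  ββ U x = cong U (βstep-involutive o G x)

  preserves : ∀ T → Dependent G T → Dependent (step o G) (T ∘ β)
  preserves T (U , U⊆T , (x , Ux) , U≡0) =
    U ∘ β , (λ y → U⊆T (β y)) , (β x , trans (ββ U x) Ux) ,
    λ u → trans (colSum-step o G U u) (rowOp-zero (multiplier o G) (proj₂ o) U≡0 u)

  reflects : ∀ T → Dependent (step o G) (T ∘ β) → Dependent G T
  reflects T (U′ , U′⊆Tβ , (x , U′x) , U′≡0) =
    U′ ∘ β , (λ y U′βy → trans (sym (ββ T y)) (U′⊆Tβ (β y) U′βy)) , (β x , trans (ββ U′ x) U′x) ,
    rowOp-kernel (multiplier o G) (proj₂ o) (multiplier-pivot o G)
      (λ u → trans (sym (colSum-step o G (U′ ∘ β) u))
                   (trans (colSum-resp (step o G) (ββ U′) u) (U′≡0 u)))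

induced-circuit : (os : List (Op n)) (G : Graph n) {T : LSet n} →
  Circuit (applyOps os G) T → Circuit G (T ∘ induced os G)
induced-circuit []       G c = c
induced-circuit (o ∷ os) G c =
  Isomorphism.circuit (Isomorphism.inverse (step-isomorphism o G)) (induced-circuit os (step o G) c)

-- Subtransversality is preserved, as β^v_* permutes each vertex triple.

AtMostOne : (Kind → Bool) → Set
AtMostOne f = ¬ (f φ ≡ true × f χ ≡ true) × ¬ (f φ ≡ true × f ψ ≡ true) × ¬ (f χ ≡ true × f ψ ≡ true)

AtMostOne-permute : ∀ p f → AtMostOne f → AtMostOne (f ∘ permute p)
AtMostOne-permute keep   f h = h
AtMostOne-permute swapχψ f (¬φχ , ¬φψ , ¬χψ) = ¬φψ , ¬φχ , ¬χψ ∘ swap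
AtMostOne-permute swapφψ f (¬φχ , ¬φψ , ¬χψ) = ¬χψ ∘ swap , ¬φψ ∘ swap , ¬φχ ∘ swap
AtMostOne-permute swapφχ f (¬φχ , ¬φψ , ¬χψ) = ¬φχ ∘ swap , ¬χψ , ¬φψ

AtMostOne-resp : {f g : Kind → Bool} → (∀ k → f k ≡ g k) → AtMostOne f → AtMostOne g
AtMostOne-resp f≗g (¬φχ , ¬φψ , ¬χψ) =
  (λ (a , b) → ¬φχ (trans (f≗g φ) a , trans (f≗g χ) b)) ,
  (λ (a , b) → ¬φψ (trans (f≗g φ) a , trans (f≗g ψ) b)) ,
  (λ (a , b) → ¬χψ (trans (f≗g χ) a , trans (f≗g ψ) b))

subtransversal-step : (o : Op n) (G : Graph n) {S : LSet n} →
  Subtransversal S → Subtransversal (S ∘ βstep o G)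
subtransversal-step o G {S} st w =
  AtMostOne-resp (λ k → cong S (sym (βstep-perm o G w k)))
                 (AtMostOne-permute (βperm o G w) (λ k → S (w , k)) (st w))

ConcentratedAt : LSet n → Fin n → Set
ConcentratedAt U v = ∀ w → w ≢ v → U (w , χ) ≡ false × U (w , ψ) ≡ false

pivotPart : Graph n → LSet n → Fin n → Fin n → Bool
pivotPart G U v u = (U (v , χ) ∧ adj G u v) xor (U (v , ψ) ∧ (adj G u v xor eqᵇ u v))

vertexTerm-concentrated : (G : Graph n) (U : LSet n) (v : Fin n) → ConcentratedAt U v →
  ∀ w u → vertexTerm G U w u ≡ (U (w , φ) ∧ eqᵇ u w) xor (pivotPart G U v u ∧ eqᵇ w v)
vertexTerm-concentrated G U v conc w u with w ≟ v
... | yes refl = trans (xor-assoc (U (w , φ) ∧ eqᵇ u w) _ _)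
                       (cong ((U (w , φ) ∧ eqᵇ u w) xor_) (sym (∧-identityʳ (pivotPart G U w u))))
... | no w≢v   = begin
  ((x xor (U (w , χ) ∧ adj G u w)) xor (U (w , ψ) ∧ (adj G u w xor eqᵇ u w)))
    ≡⟨ cong₂ (λ a b → (x xor (a ∧ adj G u w)) xor (b ∧ (adj G u w xor eqᵇ u w)))
             (proj₁ (conc w w≢v)) (proj₂ (conc w w≢v)) ⟩
  (x xor false) xor false    ≡⟨ xor-identityʳ (x xor false) ⟩
  x xor false                ≡⟨ xor-identityʳ x ⟩
  x                          ≡⟨ sym (xor-∧-false x (pivotPart G U v u)) ⟩
  x xor (pivotPart G U v u ∧ false) ∎
  where
  open ≡-Reasoning
  x = U (w , φ) ∧ eqᵇ u w

colSum-concentrated : (G : Graph n) (U : LSet n) (v : Fin n) → ConcentratedAt U v →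
  ∀ u → colSum G U u ≡ U (u , φ) xor pivotPart G U v u
colSum-concentrated G U v conc u = begin
  colSum G U u
    ≡⟨ ⊕Σ-cong (λ w → vertexTerm-concentrated G U v conc w u) ⟩
  ⊕Σ (λ w → (U (w , φ) ∧ eqᵇ u w) xor (pivotPart G U v u ∧ eqᵇ w v))
    ≡⟨ ⊕Σ-linear (λ w → U (w , φ) ∧ eqᵇ u w) (λ w → eqᵇ w v) (pivotPart G U v u) ⟩
  ⊕Σ (λ w → U (w , φ) ∧ eqᵇ u w) xor (pivotPart G U v u ∧ ⊕Σ (λ w → eqᵇ w v))
    ≡⟨ cong₂ (λ a b → a xor (pivotPart G U v u ∧ b))
             (⊕Σ-point _ u (λ w w≢u → trans (cong (U (w , φ) ∧_) (eqᵇ-≢ (λ u≡w → w≢u (sym u≡w))))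
                                            (∧-zeroʳ _)))
             (⊕Σ-point _ v (λ w w≢v → eqᵇ-≢ w≢v)) ⟩
  (U (u , φ) ∧ eqᵇ u u) xor (pivotPart G U v u ∧ eqᵇ v v)
    ≡⟨ cong₂ (λ a b → (U (u , φ) ∧ a) xor (pivotPart G U v u ∧ b)) (eqᵇ-refl u) (eqᵇ-refl v) ⟩
  (U (u , φ) ∧ true) xor (pivotPart G U v u ∧ true)
    ≡⟨ cong₂ _xor_ (∧-identityʳ (U (u , φ))) (∧-identityʳ (pivotPart G U v u)) ⟩
  U (u , φ) xor pivotPart G U v u ∎
  where open ≡-Reasoning

⊆-false : {U T : LSet n} → U ⊆ T → ∀ x → T x ≡ false → U x ≡ false
⊆-false {U = U} U⊆T x Tx≡false with U x in Ux
... | false = refl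
... | true  = trans (sym (U⊆T x Ux)) Tx≡false

⊆ζ-pivot : (H : Graph n) (v : Fin n) {U : LSet n} → U ⊆ ζ H v →
  (U (v , χ) ≡ true → not (adj H v v) ≡ true) × (U (v , ψ) ≡ true → adj H v v ≡ true)
⊆ζ-pivot H v U⊆ζ =
  (λ h → trans (cong (_∧ not (adj H v v)) (sym (eqᵇ-refl v))) (U⊆ζ (v , χ) h)) ,
  (λ h → trans (cong (_∧ adj H v v) (sym (eqᵇ-refl v))) (U⊆ζ (v , ψ) h))

⊆ζ-concentrated : (H : Graph n) (v : Fin n) {U : LSet n} → U ⊆ ζ H v → ConcentratedAt U v
⊆ζ-concentrated H v U⊆ζ w w≢v =
  ⊆-false U⊆ζ (w , χ) (cong (_∧ not (adj H v v)) (eqᵇ-≢ w≢v)) ,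
  ⊆-false U⊆ζ (w , ψ) (cong (_∧ adj H v v) (eqᵇ-≢ w≢v))

-- With a ≡ U(v,χ), b ≡ U(v,ψ), L the loop status, m the neighbour
-- indicator and e the identity entry: the v-columns of U sum to (a ⊕ b)·N(v).
pivotPart-ζ-bool : ∀ L a b m e → (a ≡ true → not L ≡ true) → (b ≡ true → L ≡ true) →
  (a ∧ (m xor (e ∧ L))) xor (b ∧ ((m xor (e ∧ L)) xor e)) ≡ (a xor b) ∧ m
pivotPart-ζ-bool false false false m e _  _  = refl
pivotPart-ζ-bool false true  false m e _  _  = trans (xor-identityʳ _) (xor-∧-false m e)
pivotPart-ζ-bool false a     true  m e _  hb with hb refl
... | ()
pivotPart-ζ-bool true  true  b     m e ha _  with ha refl
... | ()
pivotPart-ζ-bool true  false false m e _  _  = refl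
pivotPart-ζ-bool true  false true  m e _  _  =
  solve 2 (λ m e → (m :+ (e :* con true)) :+ e := m) refl m e
  where open xor-∧-Solver using (con)

ζ-colSum : (H : Graph n) (v : Fin n) {U : LSet n} → U ⊆ ζ H v → ∀ u →
  colSum H U u ≡ U (u , φ) xor ((U (v , χ) xor U (v , ψ)) ∧ nbr H v u)
ζ-colSum H v {U} U⊆ζ u = trans (colSum-concentrated H U v (⊆ζ-concentrated H v U⊆ζ) u)
  (cong (U (u , φ) xor_)
    (trans (cong (λ a → (U (v , χ) ∧ a) xor (U (v , ψ) ∧ (a xor eqᵇ u v))) (adj-column H v u))
           (pivotPart-ζ-bool (adj H v v) (U (v , χ)) (U (v , ψ)) (nbr H v u) (eqᵇ u v)
                             (proj₁ (⊆ζ-pivot H v U⊆ζ)) (proj₂ (⊆ζ-pivot H v U⊆ζ)))))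

-- The columns of ζ_H(v) sum to N(v) + N(v) = 0.
ζ-dependent : (H : Graph n) (v : Fin n) → Dependent H (ζ H v)
ζ-dependent H v = ζ H v , (λ _ h → h) , nonempty , sums-to-zero
  where
  nonempty : Nonempty (ζ H v)
  nonempty with adj H v v in loop
  ... | false = (v , χ) , cong₂ (λ e l → e ∧ not l) (eqᵇ-refl v) loop
  ... | true  = (v , ψ) , cong₂ _∧_ (eqᵇ-refl v) loop
  pivotSum : ζ H v (v , χ) xor ζ H v (v , ψ) ≡ true
  pivotSum with adj H v v
  ... | false = cong (λ e → (e ∧ true) xor (e ∧ false)) (eqᵇ-refl v)
  ... | true  = cong (λ e → (e ∧ false) xor (e ∧ true)) (eqᵇ-refl v)
  sums-to-zero : ∀ u → colSum H (ζ H v) u ≡ false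
  sums-to-zero u = trans (ζ-colSum H v (λ _ h → h) u)
                 (trans (cong (λ c → nbr H v u xor (c ∧ nbr H v u)) pivotSum) (xor-same (nbr H v u)))

xor≡false⇒≡ : ∀ a b → a xor b ≡ false → a ≡ b
xor≡false⇒≡ false b h = sym h
xor≡false⇒≡ true  false ()
xor≡false⇒≡ true  true  _ = refl

pivot-scalar-bool : ∀ L a b → (a ≡ true → not L ≡ true) → (b ≡ true → L ≡ true) →
  a ≡ (a xor b) ∧ not L × b ≡ (a xor b) ∧ L
pivot-scalar-bool false false false _  _  = refl , refl
pivot-scalar-bool false true  false _  _  = refl , refl
pivot-scalar-bool false a     true  _  hb with hb refl
... | ()
pivot-scalar-bool true  true  b     ha _  with ha refl
... | ()
pivot-scalar-bool true  false false _  _  = refl , refl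
pivot-scalar-bool true  false true  _  _  = refl , refl

-- A subset of ζ_H(v) with zero column sum is c·ζ_H(v) for a scalar c:
-- the only dependent subset of ζ_H(v) is ζ_H(v) itself.
⊆ζ-scalar : (H : Graph n) (v : Fin n) {U : LSet n} → U ⊆ ζ H v →
  (∀ u → colSum H U u ≡ false) → ∀ x → U x ≡ (U (v , χ) xor U (v , ψ)) ∧ ζ H v x
⊆ζ-scalar H v {U} U⊆ζ U≡0 (w , φ) = xor≡false⇒≡ _ _ (trans (sym (ζ-colSum H v U⊆ζ w)) (U≡0 w))
⊆ζ-scalar H v {U} U⊆ζ U≡0 (w , χ) with w ≟ v
... | yes refl = proj₁ (pivot-scalar-bool (adj H w w) _ _ (proj₁ pivot) (proj₂ pivot))
  where pivot = ⊆ζ-pivot H w U⊆ζ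
... | no w≢v   = trans (proj₁ (⊆ζ-concentrated H v U⊆ζ w w≢v)) (sym (∧-zeroʳ _))
⊆ζ-scalar H v {U} U⊆ζ U≡0 (w , ψ) with w ≟ v
... | yes refl = proj₂ (pivot-scalar-bool (adj H w w) _ _ (proj₁ pivot) (proj₂ pivot))
  where pivot = ⊆ζ-pivot H w U⊆ζ
... | no w≢v   = trans (proj₂ (⊆ζ-concentrated H v U⊆ζ w w≢v)) (sym (∧-zeroʳ _))

-- A proper subset T of ζ_H(v) is independent: a dependent U ⊆ T is c·ζ_H(v),
-- and nonemptiness forces c = 1, i.e. U = ζ_H(v), contradicting T ⊂ ζ_H(v).
ζ-minimal : (H : Graph n) (v : Fin n) (T : LSet n) → T ⊂ ζ H v → ¬ Dependent H T
ζ-minimal H v T (T⊆ζ , (y , ζy , Ty≡false)) (U , U⊆T , (x , Ux) , U≡0) =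
  true≢false (trans (sym (U⊆T y Uy)) Ty≡false)
  where
  U⊆ζ : U ⊆ ζ H v
  U⊆ζ z Uz = T⊆ζ z (U⊆T z Uz)
  scalar = ⊆ζ-scalar H v U⊆ζ U≡0
  c≡true : (U (v , χ) xor U (v , ψ)) ≡ true
  c≡true = ∧-conicalˡ _ (ζ H v x) (trans (sym (scalar x)) Ux)
  Uy : U y ≡ true
  Uy = trans (scalar y) (cong₂ _∧_ c≡true ζy)

ζ-circuit : (H : Graph n) (v : Fin n) → Circuit H (ζ H v)
ζ-circuit H v = ζ-dependent H v , ζ-minimal H v

-- The measure for the forward direction: the number of vertex triples
-- that S meets outside φ.

meetsχψ : LSet n → Fin n → Bool
meetsχψ S w = S (w , χ) ∨ S (w , ψ)

support : LSet n → Subset n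
support S = tabulate (meetsχψ S)

weight : LSet n → ℕ
weight S = ∣ support S ∣

∈-support : (S : LSet n) {w : Fin n} → meetsχψ S w ≡ true → w Subset.∈ support S
∈-support S {w} h = lookup⇒[]= w (support S) (trans (lookup∘tabulate (meetsχψ S) w) h)

∈-support⁻ : (S : LSet n) {w : Fin n} → w Subset.∈ support S → meetsχψ S w ≡ true
∈-support⁻ S {w} w∈ = trans (sym (lookup∘tabulate (meetsχψ S) w)) ([]=⇒lookup w∈)

_≼_ : LSet n → LSet n → Set
T ≼ S = ∀ w → meetsχψ T w ≡ true → meetsχψ S w ≡ true

weight-mono : {S T : LSet n} → T ≼ S → weight T ≤ weight S
weight-mono {S = S} {T} T≼S = p⊆q⇒∣p∣≤∣q∣ (λ w∈T → ∈-support S (T≼S _ (∈-support⁻ T w∈T)))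

weight-strict : {S T : LSet n} → T ≼ S → (w : Fin n) →
  meetsχψ T w ≡ false → meetsχψ S w ≡ true → weight T < weight S
weight-strict {S = S} {T} T≼S w Tw≡false Sw≡true = p⊂q⇒∣p∣<∣q∣
  ((λ x∈T → ∈-support S (T≼S _ (∈-support⁻ T x∈T))) ,
   (w , ∈-support S Sw≡true , λ w∈T → true≢false (trans (sym (∈-support⁻ T w∈T)) Tw≡false)))

-- Case distinction on vertex equality, without abstracting x ≟ w in the goal.
by-vertex : {A : Set} (x w : Fin n) → (x ≡ w → A) → (x ≢ w → A) → A
by-vertex x w same different with x ≟ w
... | yes x≡w = same x≡w
... | no  x≢w = different x≢w

βns-pivot : (G : Graph n) (w : Fin n) (k : Kind) →
  βstep (ns , w) G (w , k) ≡ (w , permute (pivotSwap (adj G w w)) k)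
βns-pivot G w k = trans (βstep-perm (ns , w) G w k)
  (cong (λ e → (w , permute (if e then pivotSwap (adj G w w) else keep) k)) (eqᵇ-refl w))

βns-off : (G : Graph n) {x y : Fin n} → x ≢ y → (k : Kind) → βstep (ns , y) G (x , k) ≡ (x , k)
βns-off G {x} {y} x≢y k = trans (βstep-perm (ns , y) G x k)
  (cong (λ e → (x , permute (if e then pivotSwap (adj G y y) else keep) k)) (eqᵇ-≢ x≢y))

meetsχψ-off : (G : Graph n) (S : LSet n) {x y : Fin n} → x ≢ y →
  meetsχψ (S ∘ βstep (ns , y) G) x ≡ meetsχψ S x
meetsχψ-off G S x≢y = cong₂ _∨_ (cong S (βns-off G x≢y χ)) (cong S (βns-off G x≢y ψ))

meetsχψ-pivot : (G : Graph n) (S : LSet n) (w : Fin n) →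
  meetsχψ (S ∘ βstep (ns , w) G) w ≡
    S (w , permute (pivotSwap (adj G w w)) χ) ∨ S (w , permute (pivotSwap (adj G w w)) ψ)
meetsχψ-pivot G S w = cong₂ _∨_ (cong S (βns-pivot G w χ)) (cong S (βns-pivot G w ψ))

-- S is misplaced at w if it contains the element of the triple of w
-- lying neither in {φ(w)} nor in ζ_G(w): χ(w) at a looped w, ψ(w) at an unlooped w.
misplaced : Graph n → LSet n → Fin n → Bool
misplaced G S w = (S (w , χ) ∧ adj G w w) ∨ (S (w , ψ) ∧ not (adj G w w))

misplaced-meets : ∀ L a b → (a ∧ L) ∨ (b ∧ not L) ≡ true → a ∨ b ≡ true
misplaced-meets L true  b _ = refl
misplaced-meets L false b h = ∧-conicalˡ b (not L) h

misplaced-pivot-bool : ∀ L (f : Kind → Bool) → AtMostOne f → (f χ ∧ L) ∨ (f ψ ∧ not L) ≡ true →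
  f (permute (pivotSwap L) χ) ∨ f (permute (pivotSwap L) ψ) ≡ false
misplaced-pivot-bool true  f (¬φχ , _ , ¬χψ) h =
  cong₂ _∨_ (¬-not (λ fφ → ¬φχ (fφ , fχ))) (¬-not (λ fψ → ¬χψ (fχ , fψ)))
  where
  fχ : f χ ≡ true
  fχ = trans (sym (trans (cong₂ _∨_ (∧-identityʳ (f χ)) (∧-zeroʳ (f ψ))) (∨-identityʳ (f χ)))) h
misplaced-pivot-bool false f (_ , ¬φψ , ¬χψ) h =
  cong₂ _∨_ (¬-not (λ fχ → ¬χψ (fχ , fψ))) (¬-not (λ fφ → ¬φψ (fφ , fψ)))
  where
  fψ : f ψ ≡ true
  fψ = trans (sym (trans (cong (_∨ (f ψ ∧ true)) (∧-zeroʳ (f χ))) (∧-identityʳ (f ψ)))) h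

pivot-meets-bool : ∀ L (f : Kind → Bool) → f φ ≡ false →
  f (permute (pivotSwap L) χ) ∨ f (permute (pivotSwap L) ψ) ≡ true → f χ ∨ f ψ ≡ true
pivot-meets-bool true  f fφ h = trans (cong (f χ ∨_) (trans (sym (cong (_∨ f ψ) fφ)) h)) (∨-zeroʳ (f χ))
pivot-meets-bool false f fφ h =
  cong (_∨ f ψ) (trans (sym (∨-identityʳ (f χ))) (trans (cong (f χ ∨_) (sym fφ)) h))

wellPlaced-bool : ∀ L a b → a ∨ b ≡ true → (a ∧ L) ∨ (b ∧ not L) ≡ false → a ≡ not L × b ≡ L
wellPlaced-bool false true  false _ _  = refl , refl
wellPlaced-bool true  false true  _ _  = refl , refl
wellPlaced-bool false false false () _
wellPlaced-bool true  false false () _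
wellPlaced-bool false false true  _ ()
wellPlaced-bool false true  true  _ ()
wellPlaced-bool true  true  false _ ()
wellPlaced-bool true  true  true  _ ()

pivot-misplaced : (G : Graph n) (S : LSet n) (w : Fin n) → Subtransversal S →
  misplaced G S w ≡ true → weight (S ∘ βstep (ns , w) G) < weight S
pivot-misplaced G S w st mis =
  weight-strict {S = S} {T = S ∘ βstep (ns , w) G} smaller w Tw≡false (misplaced-meets L (S (w , χ)) (S (w , ψ)) mis)
  where
  L = adj G w w
  Tw≡false : meetsχψ (S ∘ βstep (ns , w) G) w ≡ false
  Tw≡false = trans (meetsχψ-pivot G S w) (misplaced-pivot-bool L (λ k → S (w , k)) (st w) mis)
  smaller : (S ∘ βstep (ns , w) G) ≼ S
  smaller x h = by-vertex x w
    (λ { refl → ⊥-elim (true≢false (trans (sym h) Tw≡false)) })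
    (λ x≢w → trans (sym (meetsχψ-off G S x≢w)) h)

toggled-bool : ∀ L → (not L ∧ (L xor true)) ∨ (L ∧ not (L xor true)) ≡ true
toggled-bool false = refl
toggled-bool true  = refl

-- Local complementation at a neighbour y of w with φ(y) ∉ S toggles the
-- loop at w, making S misplaced at w, and does not increase the weight.
pivot-neighbour : (G : Graph n) (S : LSet n) {w y : Fin n} → nbr G w y ≡ true → S (y , φ) ≡ false →
  meetsχψ S w ≡ true → misplaced G S w ≡ false →
  (S ∘ βstep (ns , y) G) ≼ S × misplaced (step (ns , y) G) (S ∘ βstep (ns , y) G) w ≡ true
pivot-neighbour G S {w} {y} wy yφ∉S meets ¬mis = smaller , misplaced-now
  where
  w≢y : w ≢ y
  w≢y refl with trans (sym wy) (nbr-self G w)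
  ... | ()
  smaller : (S ∘ βstep (ns , y) G) ≼ S
  smaller x h = by-vertex x y
    (λ { refl → pivot-meets-bool (adj G x x) (λ k → S (x , k)) yφ∉S (trans (sym (meetsχψ-pivot G S x)) h) })
    (λ x≢y → trans (sym (meetsχψ-off G S x≢y)) h)
  L = adj G w w
  placed = wellPlaced-bool L (S (w , χ)) (S (w , ψ)) meets ¬mis
  misplaced-now : misplaced (step (ns , y) G) (S ∘ βstep (ns , y) G) w ≡ true
  misplaced-now = begin
    (S (βstep (ns , y) G (w , χ)) ∧ L′) ∨ (S (βstep (ns , y) G (w , ψ)) ∧ not L′)
      ≡⟨ cong₂ (λ a b → (a ∧ L′) ∨ (b ∧ not L′))
               (trans (cong S (βns-off G w≢y χ)) (proj₁ placed))
               (trans (cong S (βns-off G w≢y ψ)) (proj₂ placed)) ⟩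
    (not L ∧ L′) ∨ (L ∧ not L′)
      ≡⟨ cong (λ t → (not L ∧ (L xor t)) ∨ (L ∧ not (L xor t)))
              (cong₂ _∧_ yw yw) ⟩
    (not L ∧ (L xor true)) ∨ (L ∧ not (L xor true))
      ≡⟨ toggled-bool L ⟩
    true ∎
    where
    open ≡-Reasoning
    L′ = flipAdj ns G y w w
    yw : nbr G y w ≡ true
    yw = trans (nbr-sym G y w) wy

circuit-unique : (G : Graph n) {S T : LSet n} → Circuit G S → Dependent G T → T ⊆ S → S ≗ T
circuit-unique G {S} {T} (_ , minS) depT T⊆S x with S x in Sx | T x in Tx
... | true  | true  = refl
... | false | false = refl
... | false | true  = sym (trans (sym (T⊆S x Tx)) Sx)
... | true  | false = ⊥-elim (minS T (T⊆S , (x , Sx , Tx)) depT)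

-- The φ-columns form the identity matrix, so a set of φ's is independent.
φ-only-independent : (G : Graph n) {S : LSet n} → Dependent G S → (∀ w → meetsχψ S w ≡ false) → ⊥
φ-only-independent G {S} (U , U⊆S , (x , Ux) , U≡0) none = true≢false (trans (sym Ux) (U≡false x))
  where
  noχψ : ∀ w → U (w , χ) ≡ false × U (w , ψ) ≡ false
  noχψ w = ⊆-false U⊆S (w , χ) (∨-conicalˡ _ _ (none w)) , ⊆-false U⊆S (w , ψ) (∨-conicalʳ _ _ (none w))
  noφ : ∀ u → U (u , φ) ≡ false
  noφ u = trans (sym (xor-identityʳ (U (u , φ))))
    (trans (cong₂ (λ a b → U (u , φ) xor ((a ∧ adj G u u) xor (b ∧ (adj G u u xor eqᵇ u u))))
                  (sym (proj₁ (noχψ u))) (sym (proj₂ (noχψ u))))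
           (trans (sym (colSum-concentrated G U u (λ w _ → noχψ w) u)) (U≡0 u)))
  U≡false : ∀ x → U x ≡ false
  U≡false (w , φ) = noφ w
  U≡false (w , χ) = proj₁ (noχψ w)
  U≡false (w , ψ) = proj₂ (noχψ w)

Reachable : Graph n → LSet n → Set
Reachable G S = ∃[ os ] ∃[ v ] (∀ x → S x ≡ ζ (applyOps os G) v (induced os G x))

reachable-step : (o : Op n) (G : Graph n) {S : LSet n} →
  Reachable (step o G) (S ∘ βstep o G) → Reachable G S
reachable-step o G {S} (os , v , S≗ζ) =
  o ∷ os , v , λ x → trans (sym (cong S (βstep-involutive o G x))) (S≗ζ (βstep o G x))

transverse-step : (o : Op n) (G : Graph n) {S : LSet n} →
  TransverseCircuit G S → TransverseCircuit (step o G) (S ∘ βstep o G)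
transverse-step o G {S} (st , circ) =
  subtransversal-step o G {S} st , Isomorphism.circuit (step-isomorphism o G) circ

ReachableAt : (n k : ℕ) → Set
ReachableAt n k = ∀ (G : Graph n) (S : LSet n) → TransverseCircuit G S → weight S ≡ k → Reachable G S

ReachableBelow : (n k : ℕ) → Set
ReachableBelow n k = ∀ (G : Graph n) (S : LSet n) → TransverseCircuit G S → weight S < k → Reachable G S

-- Case 1: S is misplaced at w; pivot at w and apply the induction hypothesis.
fix-misplaced : (G : Graph n) (S : LSet n) {w : Fin n} → ReachableBelow n (weight S) →
  TransverseCircuit G S → misplaced G S w ≡ true → Reachable G S
fix-misplaced G S {w} ih tc mis = reachable-step (ns , w) G
  (ih (step (ns , w) G) (S ∘ βstep (ns , w) G) (transverse-step (ns , w) G tc)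
      (pivot-misplaced G S w (proj₁ tc) mis))

-- Case 2: S is well placed at w and φ(y) ∉ S for a neighbour y; pivot at y,
-- then S is misplaced at w in G^y_ns and Case 1 applies.
fix-neighbour : (G : Graph n) (S : LSet n) {w y : Fin n} → ReachableBelow n (weight S) →
  TransverseCircuit G S → nbr G w y ≡ true → S (y , φ) ≡ false →
  meetsχψ S w ≡ true → misplaced G S w ≡ false → Reachable G S
fix-neighbour G S {w} {y} ih tc wy yφ∉S meets ¬mis = reachable-step (ns , y) G
  (fix-misplaced (step (ns , y) G) T
     (λ G′ S′ tc′ lt → ih G′ S′ tc′ (<-≤-trans lt (weight-mono {S = S} {T = T} (proj₁ pivoted))))
     (transverse-step (ns , y) G tc) (proj₂ pivoted))
  where
  T = S ∘ βstep (ns , y) G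
  pivoted = pivot-neighbour G S wy yφ∉S meets ¬mis

-- Case 3: if S is well placed at w and contains φ(y) for all neighbours y of w,
-- then S contains, hence equals, the neighbourhood circuit of w.
close-up : (G : Graph n) (S : LSet n) {w : Fin n} → TransverseCircuit G S →
  meetsχψ S w ≡ true → misplaced G S w ≡ false →
  (∀ y → nbr G w y ≡ true → S (y , φ) ≡ true) → Reachable G S
close-up G S {w} (_ , circ) meets ¬mis nbrsφ =
  [] , w , circuit-unique G circ (ζ-dependent G w) ζ⊆S
  where
  placed = wellPlaced-bool (adj G w w) (S (w , χ)) (S (w , ψ)) meets ¬mis
  ζ⊆S : ζ G w ⊆ S
  ζ⊆S (y , φ) h = nbrsφ y h
  ζ⊆S (y , χ) h with eqᵇ-true {u = y} {w = w} (∧-conicalˡ _ _ h)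
  ... | refl = trans (proj₁ placed) (∧-conicalʳ _ _ h)
  ζ⊆S (y , ψ) h with eqᵇ-true {u = y} {w = w} (∧-conicalˡ _ _ h)
  ... | refl = trans (proj₂ placed) (∧-conicalʳ _ _ h)

below : {k : ℕ} → (∀ {j} → j < k → ReachableAt n j) → ReachableBelow n k
below rec G S tc lt = rec lt G S tc refl

reduce : (k : ℕ) → (∀ {j} → j < k → ReachableAt n j) → ReachableAt n k
reduce k rec G S tc refl with any? (λ w → meetsχψ S w Bool.≟ true)
... | no none = ⊥-elim (φ-only-independent G (proj₁ (proj₂ tc)) (λ w → ¬-not (λ h → none (w , h))))
... | yes (w , meets) with misplaced G S w in mis
...   | true = fix-misplaced G S (below rec) tc mis
...   | false with any? (λ y → nbr G w y ∧ not (S (y , φ)) Bool.≟ true)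
...     | yes (y , bad) =
  fix-neighbour G S (below rec) tc (∧-conicalˡ _ _ bad) (not-injective (∧-conicalʳ _ _ bad)) meets mis
...     | no none = close-up G S tc meets mis allφ
  where
  allφ : ∀ y → nbr G w y ≡ true → S (y , φ) ≡ true
  allφ y wy with S (y , φ) in yφ
  ... | true  = refl
  ... | false = ⊥-elim (none (y , cong₂ (λ a b → a ∧ not b) wy yφ))

transverse-reachable : (G : Graph n) (S : LSet n) → TransverseCircuit G S → Reachable G S
transverse-reachable {n} G S tc = <-rec (ReachableAt n) reduce (weight S) G S tc refl

theorem5 : ∀ {n : ℕ} (G : Graph n) (S : LSet n) → Subtransversal S →
    TransverseCircuit G S ⇔
      (∃[ os ] ∃[ v ] (∀ x → S x ≡ ζ (applyOps os G) v (induced os G x)))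
theorem5 G S st = mk⇔ (transverse-reachable G S) is-transverse
  where
  is-transverse : Reachable G S → TransverseCircuit G S
  is-transverse (os , v , S≗ζ) =
    st , Circuit-resp G (λ x → sym (S≗ζ x)) (induced-circuit os G (ζ-circuit (applyOps os G) v))
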